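{- Let $G$ be a random threshold graph on $n$ vertices and let $k\ge1$ be an integer. Writing $|k\text{ -core}(G)|$ for the number of vertices of the $k$-core of $G$, $$P(|k\text{ -core}(G)|=0)=\sum_{i=0}^{k-1}\left(\tfrac12\right)^{n-1}\binom{n-1}{i},$$ and for every integer $j\ge k+1$, $$P(|k\text{ -core}(G)|=j)=\left(\tfrac12\right)^{n+k-j}\binom{n+k-j-1}{k-1}.$$
   Context: The $k$-core of a graph $G$ is the maximum induced subgraph of $G$ in which every vertex has degree at least $k$ (obtained by iteratively deleting vertices of degree less than $k$); it may be empty. A threshold graph on $n$ vertices is built from a single base vertex by adding $n-1$ vertices one at a time, each either isolated or dominating (adjacent to all existing vertices); its creation sequence records $1$ for a dominating and $0$ for an isolated addition. A random threshold graph on $n$ vertices is obtained by choosing $n$ weights independently and uniformly in $[0,1]$ and joining two vertices iff their weights sum to more than $1$; it is known that this makes the creation sequence uniformly distributed on $\{0,1\}^{n-1}$. -}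

module Defs where

open import Data.Bool using (Bool; true; false; if_then_else_; _∧_)
open import Data.Nat using (ℕ; zero; suc; _≤ᵇ_) renaming (_<ᵇ_ to _<ℕᵇ_)
open import Data.Fin using (Fin; zero; suc; toℕ)
open import Data.List using (List; []; _∷_; _++_; map; sum; length; filter)
open import Data.List using () renaming (allFin to allFinL)
open import Data.Vec using (Vec; []; _∷_; lookup)
open import Data.Integer using (+_)
open import Data.Rational using (ℚ; ½; 1ℚ; 0ℚ; _*_; _+_)
open import Function using (id; _∘_)

Graph : ℕ → Set
Graph n = Fin n → Fin n → Bool

VSet : ℕ → Set
VSet n = Fin n → Bool

count : {n : ℕ} → (Fin n → Bool) → ℕ
count {n} p = length (filter (λ i → Data.Bool._≟_ (p i) true) (allFinL n))
  where import Data.Bool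

degIn : {n : ℕ} → Graph n → VSet n → Fin n → ℕ
degIn G S v = count (λ u → S u ∧ G v u)

peel : {n : ℕ} → ℕ → Graph n → VSet n → VSet n
peel k G S v = S v ∧ (k ≤ᵇ degIn G S v)

iterate : {A : Set} → ℕ → (A → A) → A → A
iterate zero    f a = a
iterate (suc r) f a = iterate r f (f a)

-- The k-core: iteratively delete vertices of degree < k.  Each non-stationary
-- round removes at least one vertex, so n rounds reach the fixed point.
kCore : {n : ℕ} → ℕ → Graph n → VSet n
kCore {n} k G = iterate n (peel k G) (λ _ → true)

kCoreSize : {n : ℕ} → ℕ → Graph n → ℕ
kCoreSize k G = count (kCore k G)

-- Threshold graph on vertices 0..m from creation sequence s ∈ {0,1}^m:
-- vertex 0 is the base vertex, vertex (i+1) is added at step i+1 and is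
-- dominating iff s[i] = true (1), isolated iff false (0).
addedDominating : {m : ℕ} → Vec Bool m → Fin (suc m) → Bool
addedDominating s zero    = false
addedDominating s (suc i) = lookup s i

thresholdGraph : {m : ℕ} → Vec Bool m → Graph (suc m)
thresholdGraph s u v =
  if toℕ u <ℕᵇ toℕ v then addedDominating s v
  else if toℕ v <ℕᵇ toℕ u then addedDominating s u
  else false

allSeqs : (m : ℕ) → List (Vec Bool m)
allSeqs zero    = [] ∷ []
allSeqs (suc m) = map (false ∷_) (allSeqs m) ++ map (true ∷_) (allSeqs m)

_^ℚ_ : ℚ → ℕ → ℚ
q ^ℚ zero  = 1ℚ
q ^ℚ suc r = q * (q ^ℚ r)

-- Probability of an event about a random threshold graph on n = suc m vertices:
-- the creation sequence is uniform on {0,1}^m, so each sequence has mass (1/2)^m.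
probRTG : (m : ℕ) → (Graph (suc m) → Bool) → ℚ
probRTG m E =
  (+ length (filter (λ s → Data.Bool._≟_ (E (thresholdGraph s)) true) (allSeqs m))
     Data.Rational./ 1) * (½ ^ℚ m)
  where import Data.Bool

sumBelow : ℕ → (ℕ → ℚ) → ℚ
sumBelow zero    f = 0ℚ
sumBelow (suc k) f = sumBelow k f + f k

toℚ : ℕ → ℚ
toℚ a = + a Data.Rational./ 1

-- Call a vertex dominating if it was added as a dominating vertex (the base vertex 0 is not). A
-- non-dominating vertex v is adjacent exactly to the dominating vertices added after it, a dominating
-- vertex to vertex 0 and to all other dominating vertices. So if the creation sequence s has fewer than
-- k ones, peeling first removes every non-dominating vertex and then every dominating one, and the k-core
-- is empty. Otherwise the k-core consists of the dominating vertices and the vertices followed by at least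
-- k dominating ones: a single peeling round of the whole graph produces this set, and it is stable.
--
-- Prepending a symbol to a sequence with at least k ones raises the core size by one; prepending to a
-- sequence with fewer ones gives core size k + 1 if a one is prepended to a sequence with exactly k − 1
-- ones, and 0 otherwise. Hence the core is empty iff s has fewer than k ones, and a sequence of length
-- a + e has core size a + k + 1 iff its first a symbols are arbitrary and the remaining e symbols are a
-- one followed by e − 1 symbols with exactly k − 1 ones: 2^a C(e − 1, k − 1) sequences, each of
-- probability 2^−(a + e).

module Submission where

open import Algebra.Bundles using (CommutativeMonoid)
open import Data.Bool using (Bool; true; false; T; _∧_; _∨_; not)
import Data.Bool as Bool
open import Data.Bool.Properties using (¬-not; ∧-idem; ∧-zeroʳ; ∧-identityʳ; ∨-identityʳ; ∨-zeroʳ)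
open import Data.Fin using (Fin; zero; suc; toℕ)
open import Data.Fin.Properties using (toℕ-injective) renaming (_≟_ to _≟ᶠ_)
import Data.Fin.Properties as Fin
import Data.Integer as ℤ
import Data.Integer.Properties as ℤ
open import Data.List using (List; []; _∷_; _++_; map; length; filter; tabulate)
open import Data.List.Properties using (filter-++; length-++)
open import Data.Nat using (ℕ; zero; suc; _+_; _^_; _∸_; _≤_; _<_; z≤n; s≤s; _≤ᵇ_; _<ᵇ_; _≡ᵇ_)
  renaming (_*_ to _*ℕ_)
open import Data.Nat.Combinatorics using (_C_; nCk+nC[k+1]≡[n+1]C[k+1])
open import Data.Nat.Properties
open import Data.Nat.Tactic.RingSolver using (solve-∀)
open import Data.Product using (_,_; _×_; ∃₂)
open import Data.Rational using (ℚ; ½; 1ℚ; toℚᵘ; _*_) renaming (_+_ to _+ℚ_)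
import Data.Rational.Properties as ℚ
open import Data.Rational.Unnormalised using (ℚᵘ; mkℚᵘ; *≡*) renaming (_+_ to _+ᵘ_; _*_ to _*ᵘ_; _≃_ to _≃ᵘ_)
import Data.Rational.Unnormalised.Properties as ℚᵘ
open import Data.Sum using (inj₁; inj₂)
open import Data.Vec using (Vec; []; _∷_; lookup)
open import Function using (_∘_)
open import Function.Bundles using (mk⇔)
open import Relation.Binary.PropositionalEquality
open import Relation.Nullary using (¬_; yes; no; does; contradiction)
open import Relation.Nullary.Decidable using (dec-true; dec-false; does-⇔)
open import Algebra.Properties.CommutativeSemigroup +-commutativeSemigroup
  using () renaming (interchange to +-interchange)
open import Algebra.Properties.CommutativeSemigroup (CommutativeMonoid.commutativeSemigroup ℚ.*-1-commutativeMonoid)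
  using () renaming (interchange to ℚ-*-interchange)

open import Defs

-- Counting Boolean predicates

bit : Bool → ℕ
bit false = 0
bit true  = 1

bit≤1 : ∀ b → bit b ≤ 1
bit≤1 false = z≤n
bit≤1 true  = s≤s z≤n

∧≡true⇒ˡ : ∀ {a b} → a ∧ b ≡ true → a ≡ true
∧≡true⇒ˡ {true} _ = refl

∧≡true⇒ʳ : ∀ {a b} → a ∧ b ≡ true → b ≡ true
∧≡true⇒ʳ {true} b≡true = b≡true

∧-absorbs : ∀ a {b} → (b ≡ true → a ≡ true) → a ∧ b ≡ b
∧-absorbs a {false} _   = ∧-zeroʳ a
∧-absorbs a {true}  b⇒a = trans (∧-identityʳ a) (b⇒a refl)

card : ∀ {n} → (Fin n → Bool) → ℕ
card {zero}  p = 0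
card {suc n} p = bit (p zero) + card (p ∘ suc)

infix 4 _⊆_
_⊆_ : ∀ {n} → (Fin n → Bool) → (Fin n → Bool) → Set
p ⊆ q = ∀ i → p i ≡ true → q i ≡ true

card-cong : ∀ {n} {p q : Fin n → Bool} → p ≗ q → card p ≡ card q
card-cong {zero}  p≗q = refl
card-cong {suc n} p≗q = cong₂ _+_ (cong bit (p≗q zero)) (card-cong (p≗q ∘ suc))

card-mono : ∀ {n} {p q : Fin n → Bool} → p ⊆ q → card p ≤ card q
card-mono {zero}  p⊆q = z≤n
card-mono {suc n} {p} p⊆q = +-mono-≤ (bit-mono (p zero) (p⊆q zero)) (card-mono (p⊆q ∘ suc))
  where
  bit-mono : ∀ a {b} → (a ≡ true → b ≡ true) → bit a ≤ bit b
  bit-mono false _   = z≤n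
  bit-mono true  a⇒b rewrite a⇒b refl = ≤-refl

card-false : ∀ n → card {n} (λ _ → false) ≡ 0
card-false zero    = refl
card-false (suc n) = card-false n

infixl 6 _∖_
_∖_ : ∀ {n} → (Fin n → Bool) → Fin n → (Fin n → Bool)
(p ∖ y) i = p i ∧ not (does (i ≟ᶠ y))

card≤1+card-∖ : ∀ {n} (p : Fin n → Bool) y → card p ≤ suc (card (p ∖ y))
card≤1+card-∖ {suc n} p zero = begin
  bit (p zero) + card (p ∘ suc)        ≤⟨ +-monoˡ-≤ (card (p ∘ suc)) (bit≤1 (p zero)) ⟩
  suc (card (p ∘ suc))                 ≡⟨ cong₂ (λ b c → suc (bit b + c)) (∧-zeroʳ (p zero)) (card-cong (λ i → ∧-identityʳ (p (suc i)))) ⟨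
  suc (card (p ∖ zero))                ∎
  where open ≤-Reasoning
card≤1+card-∖ {suc n} p (suc y) = begin
  bit (p zero) + card (p ∘ suc)                  ≤⟨ +-monoʳ-≤ (bit (p zero)) (card≤1+card-∖ (p ∘ suc) y) ⟩
  bit (p zero) + suc (card ((p ∘ suc) ∖ y))      ≡⟨ +-suc (bit (p zero)) _ ⟩
  suc (bit (p zero) + card ((p ∘ suc) ∖ y))      ≡⟨ cong (λ b → suc (bit b + card ((p ∘ suc) ∖ y))) (∧-identityʳ (p zero)) ⟨
  suc (card (p ∖ suc y))                         ∎
  where open ≤-Reasoning

-- The counting idiom of `count` and `probRTG`, so that both unfold to `countᵇ` definitionally.
countᵇ : {A : Set} → (A → Bool) → List A → ℕ
countᵇ P xs = length (filter (λ x → P x Bool.≟ true) xs)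

countᵇ-∷ : ∀ {A : Set} (P : A → Bool) x xs → countᵇ P (x ∷ xs) ≡ bit (P x) + countᵇ P xs
countᵇ-∷ P x xs with P x
... | true  = refl
... | false = refl

countᵇ-tabulate : ∀ {A : Set} {n} (P : A → Bool) (f : Fin n → A) → countᵇ P (tabulate f) ≡ card (P ∘ f)
countᵇ-tabulate {n = zero}  P f = refl
countᵇ-tabulate {n = suc n} P f =
  trans (countᵇ-∷ P (f zero) (tabulate (f ∘ suc))) (cong (bit (P (f zero)) +_) (countᵇ-tabulate P (f ∘ suc)))

count≡card : ∀ {n} (p : Fin n → Bool) → count p ≡ card p
count≡card p = countᵇ-tabulate p (λ i → i)

countᵇ-++ : ∀ {A : Set} (P : A → Bool) xs ys → countᵇ P (xs ++ ys) ≡ countᵇ P xs + countᵇ P ys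
countᵇ-++ P xs ys = trans (cong length (filter-++ (λ x → P x Bool.≟ true) xs ys)) (length-++ (filter _ xs))

countᵇ-map : ∀ {A B : Set} (P : B → Bool) (f : A → B) xs → countᵇ P (map f xs) ≡ countᵇ (P ∘ f) xs
countᵇ-map P f []       = refl
countᵇ-map P f (x ∷ xs) = begin
  countᵇ P (f x ∷ map f xs)          ≡⟨ countᵇ-∷ P (f x) (map f xs) ⟩
  bit (P (f x)) + countᵇ P (map f xs) ≡⟨ cong (bit (P (f x)) +_) (countᵇ-map P f xs) ⟩
  bit (P (f x)) + countᵇ (P ∘ f) xs   ≡⟨ countᵇ-∷ (P ∘ f) x xs ⟨
  countᵇ (P ∘ f) (x ∷ xs)             ∎
  where open ≡-Reasoning

countᵇ-cong : ∀ {A : Set} {P Q : A → Bool} → P ≗ Q → ∀ xs → countᵇ P xs ≡ countᵇ Q xs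
countᵇ-cong P≗Q []       = refl
countᵇ-cong {P = P} {Q} P≗Q (x ∷ xs) = begin
  countᵇ P (x ∷ xs)         ≡⟨ countᵇ-∷ P x xs ⟩
  bit (P x) + countᵇ P xs   ≡⟨ cong₂ _+_ (cong bit (P≗Q x)) (countᵇ-cong P≗Q xs) ⟩
  bit (Q x) + countᵇ Q xs   ≡⟨ countᵇ-∷ Q x xs ⟨
  countᵇ Q (x ∷ xs)         ∎
  where open ≡-Reasoning

countᵇ-false : ∀ {A : Set} (xs : List A) → countᵇ (λ _ → false) xs ≡ 0
countᵇ-false []       = refl
countᵇ-false (_ ∷ xs) = countᵇ-false xs

countᵇ-+ : ∀ {A : Set} {P Q R : A → Bool} → (∀ x → bit (P x) ≡ bit (Q x) + bit (R x)) →
  ∀ xs → countᵇ P xs ≡ countᵇ Q xs + countᵇ R xs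
countᵇ-+ split []       = refl
countᵇ-+ {P = P} {Q} {R} split (x ∷ xs) = begin
  countᵇ P (x ∷ xs)                                            ≡⟨ countᵇ-∷ P x xs ⟩
  bit (P x) + countᵇ P xs                                      ≡⟨ cong₂ _+_ (split x) (countᵇ-+ split xs) ⟩
  (bit (Q x) + bit (R x)) + (countᵇ Q xs + countᵇ R xs)        ≡⟨ +-interchange (bit (Q x)) (bit (R x)) _ _ ⟩
  (bit (Q x) + countᵇ Q xs) + (bit (R x) + countᵇ R xs)        ≡⟨ cong₂ _+_ (countᵇ-∷ Q x xs) (countᵇ-∷ R x xs) ⟨
  countᵇ Q (x ∷ xs) + countᵇ R (x ∷ xs)                        ∎
  where open ≡-Reasoning

-- Neighbourhoods in a threshold graph

ones : ∀ {m} → Vec Bool m → ℕ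
ones s = card (lookup s)

onesAfter : ∀ {m} → Vec Bool m → Fin (suc m) → ℕ
onesAfter s       zero    = ones s
onesAfter (_ ∷ s) (suc v) = onesAfter s v

onesAfter≤ones : ∀ {m} (s : Vec Bool m) v → onesAfter s v ≤ ones s
onesAfter≤ones s       zero    = ≤-refl
onesAfter≤ones (b ∷ s) (suc v) = ≤-trans (onesAfter≤ones s v) (m≤n+m (ones s) (bit b))

laterDominating : ∀ {m} → Vec Bool m → Fin (suc m) → Fin (suc m) → Bool
laterDominating s v u = (toℕ v <ᵇ toℕ u) ∧ addedDominating s u

card-laterDominating : ∀ {m} (s : Vec Bool m) v → card (laterDominating s v) ≡ onesAfter s v
card-laterDominating s       zero    = refl
card-laterDominating (b ∷ s) (suc v) = trans (card-cong shift) (card-laterDominating s v)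
  where
  shift : laterDominating (b ∷ s) (suc v) ∘ suc ≗ laterDominating s v
  shift zero    = refl
  shift (suc u) = refl

adjacent-nondominating : ∀ {m} (s : Vec Bool m) {v} → addedDominating s v ≡ false →
  thresholdGraph s v ≗ laterDominating s v
adjacent-nondominating s {v} v-isolated u with toℕ v <ᵇ toℕ u
... | true  = refl
... | false with toℕ u <ᵇ toℕ v
...   | true  = v-isolated
...   | false = refl

<ᵇ≡false⇒≮ : ∀ {m n} → (m <ᵇ n) ≡ false → ¬ m < n
<ᵇ≡false⇒≮ m≮ᵇn m<n = subst T m≮ᵇn (<⇒<ᵇ m<n)

adjacent-dominating : ∀ {m} (s : Vec Bool m) {v u} → addedDominating s v ≡ true → addedDominating s u ≡ true →
  u ≢ v → thresholdGraph s v u ≡ true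
adjacent-dominating s {v} {u} v-dominating u-dominating u≢v with toℕ v <ᵇ toℕ u in v≮u
... | true  = u-dominating
... | false with toℕ u <ᵇ toℕ v in u≮v
...   | true  = v-dominating
...   | false = contradiction (toℕ-injective (≤-antisym (≮⇒≥ (<ᵇ≡false⇒≮ v≮u)) (≮⇒≥ (<ᵇ≡false⇒≮ u≮v)))) u≢v

degIn≡card : ∀ {n} (G : Graph n) S v → degIn G S v ≡ card (λ u → S u ∧ G v u)
degIn≡card G S v = count≡card (λ u → S u ∧ G v u)

degIn≤card : ∀ {n} (G : Graph n) S v → degIn G S v ≤ card S
degIn≤card G S v = ≤-trans (≤-reflexive (degIn≡card G S v)) (card-mono {p = λ u → S u ∧ G v u} {S} (λ u → ∧≡true⇒ˡ))

module _ {m} (s : Vec Bool m) (S : VSet (suc m)) where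

  private
    G = thresholdGraph s

  degIn-nondominating≤ : ∀ {v} → addedDominating s v ≡ false → degIn G S v ≤ onesAfter s v
  degIn-nondominating≤ {v} v-isolated = begin
    degIn G S v                       ≡⟨ degIn≡card G S v ⟩
    card (λ u → S u ∧ G v u)          ≤⟨ card-mono {p = λ u → S u ∧ G v u} {laterDominating s v}
                                           (λ u h → trans (sym (adjacent-nondominating s v-isolated u)) (∧≡true⇒ʳ h)) ⟩
    card (laterDominating s v)        ≡⟨ card-laterDominating s v ⟩
    onesAfter s v                     ∎
    where open ≤-Reasoning

  degIn-nondominating : ∀ {v} → addedDominating s v ≡ false → addedDominating s ⊆ S → degIn G S v ≡ onesAfter s v
  degIn-nondominating {v} v-isolated dominating⊆S = begin
    degIn G S v                  ≡⟨ degIn≡card G S v ⟩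
    card (λ u → S u ∧ G v u)     ≡⟨ card-cong {p = λ u → S u ∧ G v u} {laterDominating s v} later ⟩
    card (laterDominating s v)   ≡⟨ card-laterDominating s v ⟩
    onesAfter s v                ∎
    where
    open ≡-Reasoning
    later : ∀ u → S u ∧ G v u ≡ laterDominating s v u
    later u = trans (cong (S u ∧_) (adjacent-nondominating s v-isolated u)) (∧-absorbs (S u) (dominating⊆S u ∘ ∧≡true⇒ʳ))

  ones≤degIn-dominating : ∀ {v} → addedDominating s v ≡ true → S zero ≡ true → addedDominating s ⊆ S →
    ones s ≤ degIn G S v
  ones≤degIn-dominating {suc i} i-dominating base∈S dominating⊆S = begin
    ones s                                              ≤⟨ card≤1+card-∖ (lookup s) i ⟩
    suc (card (lookup s ∖ i))                           ≤⟨ s≤s (card-mono {p = lookup s ∖ i} {neighbour} later) ⟩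
    suc (card neighbour)                                ≡⟨ cong (λ b → bit b + card neighbour) (cong₂ _∧_ base∈S i-dominating) ⟨
    card (λ u → S u ∧ G (suc i) u)                      ≡⟨ degIn≡card G S (suc i) ⟨
    degIn G S (suc i)                                   ∎
    where
    open ≤-Reasoning
    neighbour : Fin m → Bool
    neighbour u = S (suc u) ∧ G (suc i) (suc u)
    later : lookup s ∖ i ⊆ neighbour
    later u h with u ≟ᶠ i
    ... | yes refl = contradiction (∧≡true⇒ʳ {lookup s u} h) λ ()
    ... | no u≢i   = cong₂ _∧_ (dominating⊆S (suc u) (∧≡true⇒ˡ h))
                               (adjacent-dominating s i-dominating (∧≡true⇒ˡ h) (u≢i ∘ Fin.suc-injective))

-- The k-core of a threshold graph

module _ {n} (k : ℕ) (G : Graph n) where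

  peel-cong : ∀ {S S′} → S ≗ S′ → peel k G S ≗ peel k G S′
  peel-cong {S} {S′} S≗S′ v = cong₂ (λ b d → b ∧ (k ≤ᵇ d)) (S≗S′ v) degIn≡
    where
    degIn≡ : degIn G S v ≡ degIn G S′ v
    degIn≡ = begin
      degIn G S v                 ≡⟨ degIn≡card G S v ⟩
      card (λ u → S u ∧ G v u)    ≡⟨ card-cong {p = λ u → S u ∧ G v u} {λ u → S′ u ∧ G v u} (λ u → cong (_∧ G v u) (S≗S′ u)) ⟩
      card (λ u → S′ u ∧ G v u)   ≡⟨ degIn≡card G S′ v ⟨
      degIn G S′ v                ∎
      where open ≡-Reasoning

  iterate-peel-stable : ∀ r {X T} → X ≗ T → peel k G T ≗ T → iterate r (peel k G) X ≗ T
  iterate-peel-stable zero    X≗T _      = X≗T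
  iterate-peel-stable (suc r) X≗T stable = iterate-peel-stable r (λ v → trans (peel-cong X≗T v) (stable v)) stable

coreSet : ∀ {m} → ℕ → Vec Bool m → VSet (suc m)
coreSet k s v = (k ≤ᵇ onesAfter s v) ∨ addedDominating s v

module _ {m} (k : ℕ) (s : Vec Bool m) where

  private
    G = thresholdGraph s

  dominating⊆coreSet : addedDominating s ⊆ coreSet k s
  dominating⊆coreSet v v-dominating = trans (cong ((k ≤ᵇ onesAfter s v) ∨_) v-dominating) (∨-zeroʳ _)

  -- `k ≤ᵇ n` is definitionally `does (k ≤? n)`, so `dec-true` and `dec-false` decide it.
  peel-many-dominating : ∀ {S} → k ≤ ones s → S zero ≡ true → addedDominating s ⊆ S →
    peel k G S ≗ (λ v → S v ∧ coreSet k s v)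
  peel-many-dominating {S} k≤ones base∈S dominating⊆S v = cong (S v ∧_) (survives (addedDominating s v) refl)
    where
    survives : ∀ b → addedDominating s v ≡ b → (k ≤ᵇ degIn G S v) ≡ coreSet k s v
    survives false v-isolated = begin
      k ≤ᵇ degIn G S v                          ≡⟨ cong (k ≤ᵇ_) (degIn-nondominating s S v-isolated dominating⊆S) ⟩
      k ≤ᵇ onesAfter s v                        ≡⟨ ∨-identityʳ _ ⟨
      (k ≤ᵇ onesAfter s v) ∨ false              ≡⟨ cong ((k ≤ᵇ onesAfter s v) ∨_) v-isolated ⟨
      coreSet k s v                             ∎
      where open ≡-Reasoning
    survives true v-dominating =
      trans (dec-true (k ≤? degIn G S v) (≤-trans k≤ones (ones≤degIn-dominating s S v-dominating base∈S dominating⊆S)))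
            (sym (dominating⊆coreSet v v-dominating))

  kCore-many-dominating : k ≤ ones s → kCore k G ≗ coreSet k s
  kCore-many-dominating k≤ones = iterate-peel-stable k G m
    (peel-many-dominating k≤ones refl (λ _ _ → refl))
    (λ v → trans (peel-many-dominating k≤ones base∈coreSet dominating⊆coreSet v) (∧-idem _))
    where
    base∈coreSet : coreSet k s zero ≡ true
    base∈coreSet = cong (_∨ false) (dec-true (k ≤? ones s) k≤ones)

  peel-nondominating : ∀ S v → ones s < k → addedDominating s v ≡ false → peel k G S v ≡ false
  peel-nondominating S v ones<k v-isolated =
    trans (cong (S v ∧_) (dec-false (k ≤? degIn G S v) (<⇒≱ deg<k))) (∧-zeroʳ (S v))
    where
    deg<k : degIn G S v < k
    deg<k = ≤-<-trans (degIn-nondominating≤ s S v-isolated) (≤-<-trans (onesAfter≤ones s v) ones<k)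

  peel-few-dominating-⊆ : ∀ {S} → ones s < k → peel k G S ⊆ addedDominating s
  peel-few-dominating-⊆ {S} ones<k v survives =
    ¬-not λ v-isolated → contradiction (trans (sym survives) (peel-nondominating S v ones<k v-isolated)) λ ()

  peel-few-dominating : ∀ {S} → ones s < k → S ⊆ addedDominating s → peel k G S ≗ (λ _ → false)
  peel-few-dominating {S} ones<k S⊆dominating v =
    trans (cong (S v ∧_) (dec-false (k ≤? degIn G S v) (<⇒≱ deg<k))) (∧-zeroʳ (S v))
    where
    deg<k : degIn G S v < k
    deg<k = ≤-<-trans (degIn≤card G S v) (≤-<-trans (card-mono {p = S} {addedDominating s} S⊆dominating) ones<k)

-- kCore runs m + 1 peeling rounds: one suffices for m = 0, two in general.
kCore-few-dominating : ∀ {m} k (s : Vec Bool m) → ones s < k → kCore k (thresholdGraph s) ≗ (λ _ → false)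
kCore-few-dominating         k []      ones<k zero = peel-nondominating k [] (λ _ → true) zero ones<k refl
kCore-few-dominating {suc m} k (b ∷ s) ones<k = iterate-peel-stable k (thresholdGraph (b ∷ s)) m
  (peel-few-dominating k (b ∷ s) ones<k (peel-few-dominating-⊆ k (b ∷ s) {λ _ → true} ones<k)) (λ _ → refl)

-- Size of the k-core along the creation sequence

coreSet-few-dominating : ∀ {m} k (s : Vec Bool m) → ones s < k → coreSet k s ≗ addedDominating s
coreSet-few-dominating k s ones<k v =
  cong (_∨ addedDominating s v) (dec-false (k ≤? onesAfter s v) (<⇒≱ (≤-<-trans (onesAfter≤ones s v) ones<k)))

kCoreSize-few-dominating : ∀ {m} k (s : Vec Bool m) → ones s < k → kCoreSize k (thresholdGraph s) ≡ 0
kCoreSize-few-dominating {m} k s ones<k = begin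
  kCoreSize k (thresholdGraph s)    ≡⟨ count≡card (kCore k (thresholdGraph s)) ⟩
  card (kCore k (thresholdGraph s)) ≡⟨ card-cong (kCore-few-dominating k s ones<k) ⟩
  card {suc m} (λ _ → false)        ≡⟨ card-false (suc m) ⟩
  0                                 ∎
  where open ≡-Reasoning

kCoreSize-many-dominating : ∀ {m} k (s : Vec Bool m) → k ≤ ones s →
  kCoreSize k (thresholdGraph s) ≡ suc (card (coreSet k s ∘ suc))
kCoreSize-many-dominating k s k≤ones = begin
  kCoreSize k (thresholdGraph s)    ≡⟨ count≡card (kCore k (thresholdGraph s)) ⟩
  card (kCore k (thresholdGraph s)) ≡⟨ card-cong (kCore-many-dominating k s k≤ones) ⟩
  card (coreSet k s)                ≡⟨ cong (λ b → bit (b ∨ false) + card (coreSet k s ∘ suc)) (dec-true (k ≤? ones s) k≤ones) ⟩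
  suc (card (coreSet k s ∘ suc))    ∎
  where open ≡-Reasoning

k<kCoreSize : ∀ {m} k (s : Vec Bool m) → k ≤ ones s → k < kCoreSize k (thresholdGraph s)
k<kCoreSize k s k≤ones rewrite kCoreSize-many-dominating k s k≤ones =
  s≤s (≤-trans k≤ones (card-mono {p = lookup s} {coreSet k s ∘ suc} (dominating⊆coreSet k s ∘ suc)))

kCoreSize-∷ : ∀ {m} k b (s : Vec Bool m) → k ≤ ones s →
  kCoreSize k (thresholdGraph (b ∷ s)) ≡ suc (kCoreSize k (thresholdGraph s))
kCoreSize-∷ k b s k≤ones = begin
  kCoreSize k (thresholdGraph (b ∷ s))
    ≡⟨ kCoreSize-many-dominating k (b ∷ s) (≤-trans k≤ones (m≤n+m (ones s) (bit b))) ⟩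
  suc (bit ((k ≤ᵇ ones s) ∨ b) + card (coreSet k s ∘ suc))
    ≡⟨ cong (λ c → suc (bit (c ∨ b) + card (coreSet k s ∘ suc))) (dec-true (k ≤? ones s) k≤ones) ⟩
  suc (suc (card (coreSet k s ∘ suc)))
    ≡⟨ cong suc (kCoreSize-many-dominating k s k≤ones) ⟨
  suc (kCoreSize k (thresholdGraph s)) ∎
  where open ≡-Reasoning

kCoreSize-true∷ : ∀ {m} k (s : Vec Bool m) → ones s ≡ k →
  kCoreSize (suc k) (thresholdGraph (true ∷ s)) ≡ suc (suc k)
kCoreSize-true∷ k s refl = begin
  kCoreSize (suc k) (thresholdGraph (true ∷ s))
    ≡⟨ kCoreSize-many-dominating (suc k) (true ∷ s) ≤-refl ⟩
  suc (bit ((suc k ≤ᵇ k) ∨ true) + card (coreSet (suc k) s ∘ suc))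
    ≡⟨ cong (λ b → suc (bit b + card (coreSet (suc k) s ∘ suc))) (∨-zeroʳ _) ⟩
  suc (suc (card (coreSet (suc k) s ∘ suc)))
    ≡⟨ cong (λ c → suc (suc c)) (card-cong (coreSet-few-dominating (suc k) s ≤-refl ∘ suc)) ⟩
  suc (suc k) ∎
  where open ≡-Reasoning

kCoreSize-∷≤2+k : ∀ {m} k b (s : Vec Bool m) → ones s < suc k →
  kCoreSize (suc k) (thresholdGraph (b ∷ s)) ≤ suc (suc k)
kCoreSize-∷≤2+k k false s ones<k = subst (_≤ suc (suc k)) (sym (kCoreSize-few-dominating (suc k) (false ∷ s) ones<k)) z≤n
kCoreSize-∷≤2+k k true  s ones<k with m<1+n⇒m<n∨m≡n ones<k
... | inj₁ ones<k′ = subst (_≤ suc (suc k)) (sym (kCoreSize-few-dominating (suc k) (true ∷ s) (s≤s ones<k′))) z≤n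
... | inj₂ ones≡k  = ≤-reflexive (kCoreSize-true∷ k s ones≡k)

1+k<kCoreSize-∷ : ∀ {m} k b (s : Vec Bool m) → k ≤ ones s → suc k < kCoreSize k (thresholdGraph (b ∷ s))
1+k<kCoreSize-∷ k b s k≤ones = subst (suc k <_) (sym (kCoreSize-∷ k b s k≤ones)) (s≤s (k<kCoreSize k s k≤ones))

kCoreSize≡ᵇ0 : ∀ {m} k (s : Vec Bool m) → (kCoreSize k (thresholdGraph s) ≡ᵇ 0) ≡ (ones s <ᵇ k)
kCoreSize≡ᵇ0 k s = does-⇔ (mk⇔ few-dominating (kCoreSize-few-dominating k s)) (_ ≟ 0) (ones s <? k)
  where
  few-dominating : kCoreSize k (thresholdGraph s) ≡ 0 → ones s < k
  few-dominating empty = ≰⇒> λ k≤ones → n≮0 (subst (k <_) empty (k<kCoreSize k s k≤ones))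

kCoreSize-∷≡ᵇ1+ : ∀ {m} k b (s : Vec Bool m) {j} → suc (suc k) ≤ j →
  (kCoreSize (suc k) (thresholdGraph (b ∷ s)) ≡ᵇ suc j) ≡ (kCoreSize (suc k) (thresholdGraph s) ≡ᵇ j)
kCoreSize-∷≡ᵇ1+ k b s {j} 2+k≤j = does-⇔ (mk⇔ to from) (_ ≟ suc j) (_ ≟ j)
  where
  to : kCoreSize (suc k) (thresholdGraph (b ∷ s)) ≡ suc j → kCoreSize (suc k) (thresholdGraph s) ≡ j
  to size≡1+j with suc k ≤? ones s
  ... | yes k≤ones = suc-injective (trans (sym (kCoreSize-∷ (suc k) b s k≤ones)) size≡1+j)
  ... | no  k≰ones = contradiction (subst (_≤ suc (suc k)) size≡1+j (kCoreSize-∷≤2+k k b s (≰⇒> k≰ones))) (<⇒≱ (s≤s 2+k≤j))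
  from : kCoreSize (suc k) (thresholdGraph s) ≡ j → kCoreSize (suc k) (thresholdGraph (b ∷ s)) ≡ suc j
  from size≡j with suc k ≤? ones s
  ... | yes k≤ones = trans (kCoreSize-∷ (suc k) b s k≤ones) (cong suc size≡j)
  ... | no  k≰ones = contradiction (subst (suc (suc k) ≤_) (trans (sym size≡j) (kCoreSize-few-dominating (suc k) s (≰⇒> k≰ones))) 2+k≤j) λ ()

kCoreSize-∷≡ᵇ2+k : ∀ {m} k b (s : Vec Bool m) →
  (kCoreSize (suc k) (thresholdGraph (b ∷ s)) ≡ᵇ suc (suc k)) ≡ b ∧ (ones s ≡ᵇ k)
kCoreSize-∷≡ᵇ2+k k false s = dec-false (_ ≟ suc (suc k)) size≢2+k
  where
  size≢2+k : kCoreSize (suc k) (thresholdGraph (false ∷ s)) ≢ suc (suc k)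
  size≢2+k size≡2+k with suc k ≤? ones s
  ... | yes k≤ones = <⇒≢ (1+k<kCoreSize-∷ (suc k) false s k≤ones) (sym size≡2+k)
  ... | no  k≰ones = 1+n≢0 (trans (sym size≡2+k) (kCoreSize-few-dominating (suc k) (false ∷ s) (≰⇒> k≰ones)))
kCoreSize-∷≡ᵇ2+k k true  s = does-⇔ (mk⇔ ones≡k (kCoreSize-true∷ k s)) (_ ≟ suc (suc k)) (ones s ≟ k)
  where
  ones≡k : kCoreSize (suc k) (thresholdGraph (true ∷ s)) ≡ suc (suc k) → ones s ≡ k
  ones≡k size≡2+k with suc k ≤? ones s
  ... | yes k≤ones = contradiction (sym size≡2+k) (<⇒≢ (1+k<kCoreSize-∷ (suc k) true s k≤ones))
  ... | no  k≰ones with m<1+n⇒m<n∨m≡n (≰⇒> k≰ones)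
  ...   | inj₁ ones<k = contradiction (trans (sym size≡2+k) (kCoreSize-few-dominating (suc k) (true ∷ s) (s≤s ones<k))) 1+n≢0
  ...   | inj₂ ones≡k = ones≡k

-- Counting creation sequences

countᵇ-allSeqs : ∀ m (P : Vec Bool (suc m) → Bool) →
  countᵇ P (allSeqs (suc m)) ≡ countᵇ (P ∘ (false ∷_)) (allSeqs m) + countᵇ (P ∘ (true ∷_)) (allSeqs m)
countᵇ-allSeqs m P = begin
  countᵇ P (map (false ∷_) (allSeqs m) ++ map (true ∷_) (allSeqs m))      ≡⟨ countᵇ-++ P (map (false ∷_) (allSeqs m)) _ ⟩
  countᵇ P (map (false ∷_) (allSeqs m)) + countᵇ P (map (true ∷_) (allSeqs m))
    ≡⟨ cong₂ _+_ (countᵇ-map P (false ∷_) (allSeqs m)) (countᵇ-map P (true ∷_) (allSeqs m)) ⟩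
  countᵇ (P ∘ (false ∷_)) (allSeqs m) + countᵇ (P ∘ (true ∷_)) (allSeqs m) ∎
  where open ≡-Reasoning

count-ones≡ᵇ : ∀ m i → countᵇ (λ s → ones s ≡ᵇ i) (allSeqs m) ≡ m C i
count-ones≡ᵇ zero    zero    = refl
count-ones≡ᵇ zero    (suc i) = refl
count-ones≡ᵇ (suc m) zero    = trans (countᵇ-allSeqs m _) (cong₂ _+_ (count-ones≡ᵇ m zero) (countᵇ-false (allSeqs m)))
count-ones≡ᵇ (suc m) (suc i) = begin
  countᵇ (λ s → ones s ≡ᵇ suc i) (allSeqs (suc m))
    ≡⟨ countᵇ-allSeqs m _ ⟩
  countᵇ (λ s → ones s ≡ᵇ suc i) (allSeqs m) + countᵇ (λ s → ones s ≡ᵇ i) (allSeqs m)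
    ≡⟨ cong₂ _+_ (count-ones≡ᵇ m (suc i)) (count-ones≡ᵇ m i) ⟩
  m C suc i + m C i
    ≡⟨ +-comm (m C suc i) (m C i) ⟩
  m C i + m C suc i
    ≡⟨ nCk+nC[k+1]≡[n+1]C[k+1] m i ⟩
  suc m C suc i ∎
  where open ≡-Reasoning

bit-<ᵇ-suc : ∀ x k → bit (x <ᵇ suc k) ≡ bit (x <ᵇ k) + bit (x ≡ᵇ k)
bit-<ᵇ-suc zero    zero    = refl
bit-<ᵇ-suc zero    (suc k) = refl
bit-<ᵇ-suc (suc x) zero    = refl
bit-<ᵇ-suc (suc x) (suc k) = bit-<ᵇ-suc x k

count-kCoreSize≡ᵇ : ∀ k a e →
  countᵇ (λ s → kCoreSize (suc k) (thresholdGraph s) ≡ᵇ a + suc (suc k)) (allSeqs (a + suc e)) ≡ 2 ^ a *ℕ (e C k)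
count-kCoreSize≡ᵇ k zero    e = begin
  countᵇ _ (allSeqs (suc e))
    ≡⟨ countᵇ-allSeqs e _ ⟩
  countᵇ _ (allSeqs e) + countᵇ _ (allSeqs e)
    ≡⟨ cong₂ _+_ (countᵇ-cong (kCoreSize-∷≡ᵇ2+k k false) (allSeqs e)) (countᵇ-cong (kCoreSize-∷≡ᵇ2+k k true) (allSeqs e)) ⟩
  countᵇ (λ _ → false) (allSeqs e) + countᵇ (λ s → ones s ≡ᵇ k) (allSeqs e)
    ≡⟨ cong₂ _+_ (countᵇ-false (allSeqs e)) (count-ones≡ᵇ e k) ⟩
  e C k
    ≡⟨ *-identityˡ (e C k) ⟨
  2 ^ 0 *ℕ (e C k) ∎
  where open ≡-Reasoning
count-kCoreSize≡ᵇ k (suc a) e = begin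
  countᵇ _ (allSeqs (suc (a + suc e)))
    ≡⟨ countᵇ-allSeqs (a + suc e) _ ⟩
  countᵇ _ (allSeqs (a + suc e)) + countᵇ _ (allSeqs (a + suc e))
    ≡⟨ cong₂ _+_ (shift false) (shift true) ⟩
  2 ^ a *ℕ (e C k) + 2 ^ a *ℕ (e C k)
    ≡⟨ cong (2 ^ a *ℕ (e C k) +_) (+-identityʳ _) ⟨
  2 *ℕ (2 ^ a *ℕ (e C k))
    ≡⟨ *-assoc 2 (2 ^ a) (e C k) ⟨
  2 ^ suc a *ℕ (e C k) ∎
  where
  open ≡-Reasoning
  shift : ∀ b → countᵇ (λ s → kCoreSize (suc k) (thresholdGraph (b ∷ s)) ≡ᵇ suc a + suc (suc k)) (allSeqs (a + suc e))
                ≡ 2 ^ a *ℕ (e C k)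
  shift b = trans (countᵇ-cong (λ s → kCoreSize-∷≡ᵇ1+ k b s (m≤n+m (suc (suc k)) a)) (allSeqs (a + suc e)))
                  (count-kCoreSize≡ᵇ k a e)

-- From counts to probabilities

ℕ→ℚᵘ : ℕ → ℚᵘ
ℕ→ℚᵘ a = mkℚᵘ (ℤ.+ a) 0

toℚᵘ-toℚ : ∀ a → toℚᵘ (toℚ a) ≃ᵘ ℕ→ℚᵘ a
toℚᵘ-toℚ a = ℚ.toℚᵘ-fromℚᵘ (ℕ→ℚᵘ a)

toℚ-+ : ∀ a b → toℚ (a + b) ≡ toℚ a +ℚ toℚ b
toℚ-+ a b = ℚ.toℚᵘ-injective (ℚᵘ.≃-trans (toℚᵘ-toℚ (a + b)) (ℚᵘ.≃-trans ℕ→ℚᵘ-+ (ℚᵘ.≃-sym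
  (ℚᵘ.≃-trans (ℚ.toℚᵘ-homo-+ (toℚ a) (toℚ b)) (ℚᵘ.+-cong (toℚᵘ-toℚ a) (toℚᵘ-toℚ b))))))
  where
  ℕ→ℚᵘ-+ : ℕ→ℚᵘ (a + b) ≃ᵘ ℕ→ℚᵘ a +ᵘ ℕ→ℚᵘ b
  ℕ→ℚᵘ-+ = *≡* (cong (ℤ._* ℤ.+ 1) (trans (ℤ.pos-+ a b) (sym (cong₂ ℤ._+_ (ℤ.*-identityʳ (ℤ.+ a)) (ℤ.*-identityʳ (ℤ.+ b))))))

toℚ-* : ∀ a b → toℚ (a *ℕ b) ≡ toℚ a * toℚ b
toℚ-* a b = ℚ.toℚᵘ-injective (ℚᵘ.≃-trans (toℚᵘ-toℚ (a *ℕ b)) (ℚᵘ.≃-trans ℕ→ℚᵘ-* (ℚᵘ.≃-sym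
  (ℚᵘ.≃-trans (ℚ.toℚᵘ-homo-* (toℚ a) (toℚ b)) (ℚᵘ.*-cong (toℚᵘ-toℚ a) (toℚᵘ-toℚ b))))))
  where
  ℕ→ℚᵘ-* : ℕ→ℚᵘ (a *ℕ b) ≃ᵘ ℕ→ℚᵘ a *ᵘ ℕ→ℚᵘ b
  ℕ→ℚᵘ-* = *≡* (cong (ℤ._* ℤ.+ 1) (ℤ.pos-* a b))

^ℚ-+ : ∀ q a e → q ^ℚ (a + e) ≡ q ^ℚ a * q ^ℚ e
^ℚ-+ q zero    e = sym (ℚ.*-identityˡ (q ^ℚ e))
^ℚ-+ q (suc a) e = trans (cong (q *_) (^ℚ-+ q a e)) (sym (ℚ.*-assoc q (q ^ℚ a) (q ^ℚ e)))

2^*½^≡1 : ∀ a → toℚ (2 ^ a) * ½ ^ℚ a ≡ 1ℚ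
2^*½^≡1 zero    = refl
2^*½^≡1 (suc a) = begin
  toℚ (2 *ℕ 2 ^ a) * (½ * ½ ^ℚ a)         ≡⟨ cong (_* (½ * ½ ^ℚ a)) (toℚ-* 2 (2 ^ a)) ⟩
  (toℚ 2 * toℚ (2 ^ a)) * (½ * ½ ^ℚ a)    ≡⟨ ℚ-*-interchange (toℚ 2) (toℚ (2 ^ a)) ½ (½ ^ℚ a) ⟩
  (toℚ 2 * ½) * (toℚ (2 ^ a) * ½ ^ℚ a)    ≡⟨ cong ((toℚ 2 * ½) *_) (2^*½^≡1 a) ⟩
  (toℚ 2 * ½) * 1ℚ                        ≡⟨⟩
  1ℚ                                      ∎
  where open ≡-Reasoning

*-sumBelow : ∀ h k f → h * sumBelow k f ≡ sumBelow k (λ i → h * f i)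
*-sumBelow h zero    f = ℚ.*-zeroʳ h
*-sumBelow h (suc k) f = trans (ℚ.*-distribˡ-+ h (sumBelow k f) (f k)) (cong (_+ℚ h * f k) (*-sumBelow h k f))

count-ones<ᵇ : ∀ m k → toℚ (countᵇ (λ s → ones s <ᵇ k) (allSeqs m)) ≡ sumBelow k (λ i → toℚ (m C i))
count-ones<ᵇ m zero    = cong toℚ (countᵇ-false (allSeqs m))
count-ones<ᵇ m (suc k) = begin
  toℚ (countᵇ (λ s → ones s <ᵇ suc k) (allSeqs m))
    ≡⟨ cong toℚ (countᵇ-+ (λ s → bit-<ᵇ-suc (ones s) k) (allSeqs m)) ⟩
  toℚ (countᵇ (λ s → ones s <ᵇ k) (allSeqs m) + countᵇ (λ s → ones s ≡ᵇ k) (allSeqs m))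
    ≡⟨ toℚ-+ (countᵇ (λ s → ones s <ᵇ k) (allSeqs m)) (countᵇ (λ s → ones s ≡ᵇ k) (allSeqs m)) ⟩
  toℚ (countᵇ (λ s → ones s <ᵇ k) (allSeqs m)) +ℚ toℚ (countᵇ (λ s → ones s ≡ᵇ k) (allSeqs m))
    ≡⟨ cong₂ _+ℚ_ (count-ones<ᵇ m k) (cong toℚ (count-ones≡ᵇ m k)) ⟩
  sumBelow (suc k) (λ i → toℚ (m C i)) ∎
  where open ≡-Reasoning

probability-empty-kCore : ∀ m k →
  probRTG m (λ G → kCoreSize k G ≡ᵇ 0) ≡ sumBelow k (λ i → ½ ^ℚ m * toℚ (m C i))
probability-empty-kCore m k = begin
  toℚ (countᵇ (λ s → kCoreSize k (thresholdGraph s) ≡ᵇ 0) (allSeqs m)) * ½ ^ℚ m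
    ≡⟨ cong (λ c → toℚ c * ½ ^ℚ m) (countᵇ-cong (kCoreSize≡ᵇ0 k) (allSeqs m)) ⟩
  toℚ (countᵇ (λ s → ones s <ᵇ k) (allSeqs m)) * ½ ^ℚ m
    ≡⟨ cong (_* ½ ^ℚ m) (count-ones<ᵇ m k) ⟩
  sumBelow k (λ i → toℚ (m C i)) * ½ ^ℚ m
    ≡⟨ ℚ.*-comm _ (½ ^ℚ m) ⟩
  ½ ^ℚ m * sumBelow k (λ i → toℚ (m C i))
    ≡⟨ *-sumBelow (½ ^ℚ m) k (λ i → toℚ (m C i)) ⟩
  sumBelow k (λ i → ½ ^ℚ m * toℚ (m C i)) ∎
  where open ≡-Reasoning

probability-kCoreSize : ∀ k a e →
  probRTG (a + suc e) (λ G → kCoreSize (suc k) G ≡ᵇ a + suc (suc k)) ≡ ½ ^ℚ (suc e) * toℚ (e C k)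
probability-kCoreSize k a e = begin
  toℚ (countᵇ (λ s → kCoreSize (suc k) (thresholdGraph s) ≡ᵇ a + suc (suc k)) (allSeqs (a + suc e))) * ½ ^ℚ (a + suc e)
    ≡⟨ cong₂ _*_ (trans (cong toℚ (count-kCoreSize≡ᵇ k a e)) (toℚ-* (2 ^ a) (e C k))) (^ℚ-+ ½ a (suc e)) ⟩
  (toℚ (2 ^ a) * toℚ (e C k)) * (½ ^ℚ a * ½ ^ℚ suc e)
    ≡⟨ ℚ-*-interchange (toℚ (2 ^ a)) (toℚ (e C k)) (½ ^ℚ a) (½ ^ℚ suc e) ⟩
  (toℚ (2 ^ a) * ½ ^ℚ a) * (toℚ (e C k) * ½ ^ℚ suc e)
    ≡⟨ cong (_* (toℚ (e C k) * ½ ^ℚ suc e)) (2^*½^≡1 a) ⟩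
  1ℚ * (toℚ (e C k) * ½ ^ℚ suc e)
    ≡⟨ ℚ.*-identityˡ _ ⟩
  toℚ (e C k) * ½ ^ℚ suc e
    ≡⟨ ℚ.*-comm (toℚ (e C k)) (½ ^ℚ suc e) ⟩
  ½ ^ℚ (suc e) * toℚ (e C k) ∎
  where open ≡-Reasoning

core-size-range-decomposition : ∀ {m k j} → suc k + 1 ≤ j → j ≤ suc m →
  ∃₂ λ a e → j ≡ a + suc (suc k) × m ≡ a + suc (k + e) × suc m + suc k ∸ j ≡ suc (k + e)
core-size-range-decomposition {k = k} k+1≤j j≤n with m≤n⇒∃[o]m+o≡n k+1≤j
... | a , refl with m≤n⇒∃[o]m+o≡n j≤n
...   | e , refl = a , e , rearrange-j k a , rearrange-m k a e ,
                   trans (cong (_∸ (suc k + 1 + a)) (rearrange-exponent k a e)) (m+n∸m≡n (suc k + 1 + a) (suc (k + e)))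
  where
  rearrange-j : ∀ k a → suc k + 1 + a ≡ a + suc (suc k)
  rearrange-j = solve-∀
  rearrange-m : ∀ k a e → k + 1 + a + e ≡ a + suc (k + e)
  rearrange-m = solve-∀
  rearrange-exponent : ∀ k a e → suc (k + 1 + a + e) + suc k ≡ suc k + 1 + a + suc (k + e)
  rearrange-exponent = solve-∀

probability-kCoreSize-in-range : ∀ m k j → suc k + 1 ≤ j → j ≤ suc m →
  probRTG m (λ G → kCoreSize (suc k) G ≡ᵇ j) ≡ ½ ^ℚ (suc m + suc k ∸ j) * toℚ ((suc m + suc k ∸ j ∸ 1) C k)
probability-kCoreSize-in-range m k j k+1≤j j≤n =
  let a , e , j≡ , m≡ , exponent = core-size-range-decomposition k+1≤j j≤n in begin
  probRTG m (λ G → kCoreSize (suc k) G ≡ᵇ j)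
    ≡⟨ cong₂ (λ m′ j′ → probRTG m′ (λ G → kCoreSize (suc k) G ≡ᵇ j′)) m≡ j≡ ⟩
  probRTG (a + suc (k + e)) (λ G → kCoreSize (suc k) G ≡ᵇ a + suc (suc k))
    ≡⟨ probability-kCoreSize k a (k + e) ⟩
  ½ ^ℚ suc (k + e) * toℚ ((k + e) C k)
    ≡⟨ cong (λ x → ½ ^ℚ x * toℚ ((x ∸ 1) C k)) exponent ⟨
  ½ ^ℚ (suc m + suc k ∸ j) * toℚ ((suc m + suc k ∸ j ∸ 1) C k) ∎
  where open ≡-Reasoning

mainTheorem13 : (n k : ℕ) → 1 ≤ n → 1 ≤ k →
    (probRTG (n ∸ 1) (λ G → kCoreSize k G ≡ᵇ 0)
       ≡ sumBelow k (λ i → (½ ^ℚ (n ∸ 1)) * toℚ ((n ∸ 1) C i)))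
    × ((j : ℕ) → k + 1 ≤ j → j ≤ n →
         probRTG (n ∸ 1) (λ G → kCoreSize k G ≡ᵇ j)
           ≡ (½ ^ℚ (n + k ∸ j)) * toℚ ((n + k ∸ j ∸ 1) C (k ∸ 1)))
mainTheorem13 (suc m) (suc k) _ _ = probability-empty-kCore m (suc k) , probability-kCoreSize-in-range m k
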